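{- Let $G=(V,E)$ be a Helly graph and let $S\subseteq V$ satisfy $diam(S)\le 2$. Let $v \notin S$ with $dist(v,S) = r-1$. Then there exists a vertex $pg_S(v) \in N^{r-1}[v]$ such that $S \cap N^r[v] \subseteq N[pg_S(v)]$. Moreover, $pg_S(v)$ lies in the closed neighbourhood of some gate of $v$, where a gate of $v$ is a vertex of $N^{dist(v,S)-1}[v] \cap \bigcap\{N(x) \mid x \in Pr(v,S)\}$.
   Context: For a graph $G=(V,E)$, $dist(u,v)$ is the shortest-path distance, $N(x)$ is the set of neighbours of $x$, $N[x]=N(x)\cup\{x\}$, and $N^r[v] = \{u \mid dist(u,v)\le r\}$ is the ball of center $v$ and radius $r$. A graph is Helly if every family of pairwise intersecting balls has a nonempty common intersection. For $S\subseteq V$: $dist(v,S)=\min_{s\in S} dist(v,s)$, $Pr(v,S)=\{s\in S \mid dist(v,s)=dist(v,S)\}$, and $diam(S)=\max_{x,y\in S} dist(x,y)$ (weak diameter). -}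

module Defs where

open import Data.Nat using (ℕ; zero; suc; _≤_)
open import Data.Fin using (Fin)
open import Data.Product using (Σ; _×_; ∃; ∃-syntax)
open import Data.Sum using (_⊎_)
open import Data.Empty using (⊥)
open import Relation.Binary.PropositionalEquality using (_≡_)

record Graph (n : ℕ) : Set₁ where
  field
    Adj     : Fin n → Fin n → Set
    symAdj  : ∀ {x y} → Adj x y → Adj y x
    irrAdj  : ∀ {x} → Adj x x → ⊥
open Graph public

module _ {n : ℕ} (G : Graph n) where

  data Walk : Fin n → Fin n → ℕ → Set where
    here : ∀ {u} → Walk u u zero
    step : ∀ {u w v k} → Adj G u w → Walk w v k → Walk u v (suc k)

  IsDist : Fin n → Fin n → ℕ → Set
  IsDist u v d = Walk u v d × (∀ k → Walk u v k → d ≤ k)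

  Connected : Set
  Connected = ∀ u v → ∃[ d ] IsDist u v d

  Ball : Fin n → ℕ → Fin n → Set
  Ball v r u = ∃[ d ] (IsDist u v d × d ≤ r)

  Nbhd : Fin n → Fin n → Set
  Nbhd x y = Adj G x y

  ClosedNbhd : Fin n → Fin n → Set
  ClosedNbhd x y = y ≡ x ⊎ Adj G x y

  Helly : Set₁
  Helly = (I : Set) (c : I → Fin n) (ρ : I → ℕ) →
          (∀ i j → ∃[ u ] (Ball (c i) (ρ i) u × Ball (c j) (ρ j) u)) →
          ∃[ u ] (∀ i → Ball (c i) (ρ i) u)

  -- diam(S) ≤ k  (weak diameter)
  DiamLe : (Fin n → Set) → ℕ → Set
  DiamLe S k = ∀ x y → S x → S y → ∃[ d ] (IsDist x y d × d ≤ k)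

  DistSet : Fin n → (Fin n → Set) → ℕ → Set
  DistSet v S d = (∃[ s ] (S s × IsDist v s d)) ×
                  (∀ s d' → S s → IsDist v s d' → d ≤ d')

  -- s ∈ Pr(v,S)  (given dist(v,S) = d, s ∈ S with dist(v,s) = d)
  InPr : Fin n → (Fin n → Set) → ℕ → Fin n → Set
  InPr v S d s = S s × IsDist v s d

  IsGate : Fin n → (Fin n → Set) → ℕ → Fin n → Set
  IsGate v S d g = Ball v (d Data.Nat.∸ 1) g × (∀ x → InPr v S d x → Nbhd x g)

module Submission where

-- The gate g is a common point of N^{r-2}[v], of N[x] for every projection x, and of
-- N^2[u] for every u ∈ S ∩ N^r[v]; these balls pairwise meet because diam(S) ≤ 2, so the
-- Helly property provides g, and g ≠ x since g is closer to v than any projection.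
-- Then N^{r-1}[v], N[g] and the balls N[u] (u ∈ S ∩ N^r[v]) pairwise meet, the pairs
-- (g, u) by the choice of g, and Helly gives pg_S(v).

open import Defs
open import Data.Empty using (⊥-elim)
open import Data.Fin using (Fin)
open import Data.Nat using (ℕ; zero; suc; _+_; _≤_; _<_; z≤n; s≤s; _≤?_)
open import Data.Nat.Properties
  using (+-comm; ≤-trans; ≤-refl; ≤-reflexive; ≰⇒≥; m+[n∸m]≡n; m≤n+o⇒m∸n≤o; m≤m+n; n≤1+n; <⇒≱)
open import Data.Product using (Σ; _×_; _,_; proj₁; proj₂; ∃-syntax)
open import Data.Sum using (_⊎_; inj₁; inj₂)
open import Data.Unit using (⊤; tt)
open import Relation.Binary.PropositionalEquality using (refl; sym; subst)
open import Relation.Nullary using (¬_; yes; no)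

module Walks {n : ℕ} (G : Graph n) where

  _++ʷ_ : ∀ {u w v a b} → Walk G u w a → Walk G w v b → Walk G u v (a + b)
  here ++ʷ q = q
  step e p ++ʷ q = step e (p ++ʷ q)

  reverseʷ : ∀ {u v m} → Walk G u v m → Walk G v u m
  reverseʷ here = here
  reverseʷ {m = suc m} (step e p) =
    subst (Walk G _ _) (+-comm m 1) (reverseʷ p ++ʷ step (symAdj G e) here)

  splitAtʷ : ∀ {u v} a {b} → Walk G u v (a + b) → ∃[ w ] (Walk G u w a × Walk G w v b)
  splitAtʷ zero p = _ , here , p
  splitAtʷ (suc a) (step e p) with splitAtʷ a p
  ... | w , q , r = w , step e q , r

  WalkWithin : Fin n → Fin n → ℕ → Set
  WalkWithin a b r = ∃[ m ] (Walk G a b m × m ≤ r)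

  within-refl : ∀ {a r} → WalkWithin a a r
  within-refl = 0 , here , z≤n

  within-sym : ∀ {a b r} → WalkWithin a b r → WalkWithin b a r
  within-sym (m , p , m≤r) = m , reverseʷ p , m≤r

  within-sym+ : ∀ {a b} r s → WalkWithin a b (r + s) → WalkWithin b a (s + r)
  within-sym+ r s w = subst (WalkWithin _ _) (+-comm r s) (within-sym w)

  within-mono : ∀ {a b r s} → r ≤ s → WalkWithin a b r → WalkWithin a b s
  within-mono r≤s (m , p , m≤r) = m , p , ≤-trans m≤r r≤s

  ball⇒within : ∀ {c ρ u} → Ball G c ρ u → WalkWithin u c ρ
  ball⇒within (d , (p , _) , d≤ρ) = d , p , d≤ρ

  ball₁⇒closedNbhd : ∀ {p u} → Ball G u 1 p → ClosedNbhd G p u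
  ball₁⇒closedNbhd (.0 , (here , _) , _) = inj₁ refl
  ball₁⇒closedNbhd (.1 , (step e here , _) , s≤s z≤n) = inj₂ e
  ball₁⇒closedNbhd (_ , (step _ (step _ _) , _) , s≤s ())

  closedNbhd-sym : ∀ {p u} → ClosedNbhd G p u → ClosedNbhd G u p
  closedNbhd-sym (inj₁ refl) = inj₁ refl
  closedNbhd-sym (inj₂ e) = inj₂ (symAdj G e)

  ball₁-beyond⇒adj : ∀ {v x g d r} → IsDist G v x d → r < d →
                     Ball G v r g → Ball G x 1 g → Adj G x g
  ball₁-beyond⇒adj _ _ _ g∈N with ball₁⇒closedNbhd g∈N
  ... | inj₂ e = symAdj G e
  ball₁-beyond⇒adj (_ , minimal) r<d (m , (p , _) , m≤r) _ | inj₁ refl =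
    ⊥-elim (<⇒≱ r<d (≤-trans (minimal m (reverseʷ p)) m≤r))

  ball-meeting-projections⇒gate : ∀ {v S k g} → Ball G v k g →
                                  (∀ x → InPr G v S (suc k) x → Ball G x 1 g) →
                                  IsGate G v S (suc k) g
  ball-meeting-projections⇒gate g∈N^k g∈N[x] =
    g∈N^k , λ x x∈Pr → ball₁-beyond⇒adj (proj₂ x∈Pr) ≤-refl g∈N^k (g∈N[x] x x∈Pr)

  module _ (connected : Connected G) where

    walk⇒ball : ∀ {u c m ρ} → Walk G u c m → m ≤ ρ → Ball G c ρ u
    walk⇒ball {u} {c} p m≤ρ with connected u c
    ... | d , (q , minimal) = d , (q , minimal) , ≤-trans (minimal _ p) m≤ρ

    balls-meet : ∀ {a b} ρa ρb → WalkWithin a b (ρa + ρb) →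
                 ∃[ u ] (Ball G a ρa u × Ball G b ρb u)
    balls-meet {a} ρa ρb (m , p , m≤) with m ≤? ρa
    ... | yes m≤ρa = _ , walk⇒ball (reverseʷ p) m≤ρa , walk⇒ball here z≤n
    ... | no m≰ρa with splitAtʷ ρa (subst (Walk G a _) (sym (m+[n∸m]≡n (≰⇒≥ m≰ρa))) p)
    ... | w , q , r = w , walk⇒ball (reverseʷ q) ≤-refl , walk⇒ball r (m≤n+o⇒m∸n≤o m ρa m≤)

    helly-by-walks : Helly G → {I : Set} (c : I → Fin n) (ρ : I → ℕ) →
                     (∀ i j → WalkWithin (c i) (c j) (ρ i + ρ j)) →
                     ∃[ u ] (∀ i → Ball G (c i) (ρ i) u)
    helly-by-walks helly c ρ walks = helly _ c ρ (λ i j → balls-meet (ρ i) (ρ j) (walks i j))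

    helly-meet₃ : Helly G → (a : Fin n) (ρ : ℕ) →
                  {A : Set} (cA : A → Fin n) (ρA : A → ℕ) →
                  {B : Set} (cB : B → Fin n) (ρB : B → ℕ) →
                  (∀ x → WalkWithin a (cA x) (ρ + ρA x)) →
                  (∀ y → WalkWithin a (cB y) (ρ + ρB y)) →
                  (∀ x x' → WalkWithin (cA x) (cA x') (ρA x + ρA x')) →
                  (∀ x y → WalkWithin (cA x) (cB y) (ρA x + ρB y)) →
                  (∀ y y' → WalkWithin (cB y) (cB y') (ρB y + ρB y')) →
                  ∃[ u ] (Ball G a ρ u × (∀ x → Ball G (cA x) (ρA x) u)
                                       × (∀ y → Ball G (cB y) (ρB y) u))
    helly-meet₃ helly a ρ {A} cA ρA {B} cB ρB aA aB AA AB BB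
      with helly-by-walks helly c r walks
      where
      c : ⊤ ⊎ (A ⊎ B) → Fin n
      c (inj₁ _) = a
      c (inj₂ (inj₁ x)) = cA x
      c (inj₂ (inj₂ y)) = cB y
      r : ⊤ ⊎ (A ⊎ B) → ℕ
      r (inj₁ _) = ρ
      r (inj₂ (inj₁ x)) = ρA x
      r (inj₂ (inj₂ y)) = ρB y
      walks : ∀ i j → WalkWithin (c i) (c j) (r i + r j)
      walks (inj₁ _) (inj₁ _) = within-refl
      walks (inj₁ _) (inj₂ (inj₁ x)) = aA x
      walks (inj₁ _) (inj₂ (inj₂ y)) = aB y
      walks (inj₂ (inj₁ x)) (inj₁ _) = within-sym+ ρ (ρA x) (aA x)
      walks (inj₂ (inj₂ y)) (inj₁ _) = within-sym+ ρ (ρB y) (aB y)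
      walks (inj₂ (inj₁ x)) (inj₂ (inj₁ x')) = AA x x'
      walks (inj₂ (inj₁ x)) (inj₂ (inj₂ y)) = AB x y
      walks (inj₂ (inj₂ y)) (inj₂ (inj₁ x)) = within-sym+ (ρA x) (ρB y) (AB x y)
      walks (inj₂ (inj₂ y)) (inj₂ (inj₂ y')) = BB y y'
    ... | u , u∈ = u , u∈ (inj₁ tt) , (λ x → u∈ (inj₂ (inj₁ x))) , (λ y → u∈ (inj₂ (inj₂ y)))

-- Here dist(v,S) = suc k, though only the distance from v to each projection is used.
module Gate {n : ℕ} (G : Graph n) (connected : Connected G) (helly : Helly G)
            (S : Fin n → Set) (diam : DiamLe G S 2) (v : Fin n) (k : ℕ) where
  open Walks G

  NearS : Fin n → Set
  NearS u = S u × Ball G v (suc (suc k)) u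

  private
    S-within₂ : ∀ {x y} → S x → S y → WalkWithin x y 2
    S-within₂ x∈S y∈S with diam _ _ x∈S y∈S
    ... | d , (p , _) , d≤2 = d , p , d≤2

    S-within : ∀ {x y} r → S x → S y → WalkWithin x y (2 + r)
    S-within r x∈S y∈S = within-mono (m≤m+n 2 r) (S-within₂ x∈S y∈S)

    v-within-NearS : (u : Σ (Fin n) NearS) → WalkWithin v (proj₁ u) (suc (suc k))
    v-within-NearS (_ , _ , u∈B) = within-sym (ball⇒within u∈B)

  gate-candidate : ∃[ g ] (Ball G v k g
                           × (∀ x → InPr G v S (suc k) x → Ball G x 1 g)
                           × (∀ u → NearS u → Ball G u 2 g))
  gate-candidate with helly-meet₃ connected helly v k
                        {Σ (Fin n) (InPr G v S (suc k))} proj₁ (λ _ → 1)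
                        {Σ (Fin n) NearS} proj₁ (λ _ → 2)
                        (λ { (_ , _ , p , _) → _ , p , ≤-reflexive (+-comm 1 k) })
                        (λ u → within-mono (≤-reflexive (+-comm 2 k)) (v-within-NearS u))
                        (λ { (_ , x∈S , _) (_ , y∈S , _) → S-within₂ x∈S y∈S })
                        (λ { (_ , x∈S , _) (_ , u∈S , _) → S-within 1 x∈S u∈S })
                        (λ { (_ , u∈S , _) (_ , w∈S , _) → S-within 2 u∈S w∈S })
  ... | g , g∈N^k , g∈N[x] , g∈N²[u] =
    g , g∈N^k , (λ x x∈Pr → g∈N[x] (x , x∈Pr)) , (λ u u∈S → g∈N²[u] (u , u∈S))

  projection-point : ∀ {g} → Ball G v k g → (∀ u → NearS u → Ball G u 2 g) →
                     ∃[ p ] (Ball G v (suc k) p × Ball G g 1 p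
                             × (∀ u → NearS u → Ball G u 1 p))
  projection-point {g} g∈N^k g∈N²[u]
    with helly-meet₃ connected helly v (suc k)
           {⊤} (λ _ → g) (λ _ → 1) {Σ (Fin n) NearS} proj₁ (λ _ → 1)
           (λ _ → within-mono (≤-trans (n≤1+n k) (m≤m+n (suc k) 1))
                              (within-sym (ball⇒within g∈N^k)))
           (λ u → within-mono (≤-reflexive (+-comm 1 (suc k))) (v-within-NearS u))
           (λ _ _ → within-refl)
           (λ { _ (u , u∈NearS) → ball⇒within (g∈N²[u] u u∈NearS) })
           (λ { (_ , u∈S , _) (_ , w∈S , _) → S-within₂ u∈S w∈S })
  ... | p , p∈N^k , p∈N[g] , p∈N[u] =
    p , p∈N^k , p∈N[g] tt , (λ u u∈NearS → p∈N[u] (u , u∈NearS))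

  projection-gate : ∃[ p ] (Ball G v (suc k) p
                            × (∀ u → S u → Ball G v (suc (suc k)) u → ClosedNbhd G p u)
                            × ∃[ g ] (IsGate G v S (suc k) g × ClosedNbhd G g p))
  projection-gate with gate-candidate
  ... | g , g∈N^k , g∈N[x] , g∈N²[u] with projection-point g∈N^k g∈N²[u]
  ... | p , p∈N^r , p∈N[g] , p∈N[u] =
    p , p∈N^r , (λ u u∈S u∈N^r → ball₁⇒closedNbhd (p∈N[u] u (u∈S , u∈N^r)))
      , g , ball-meeting-projections⇒gate g∈N^k g∈N[x]
      , closedNbhd-sym (ball₁⇒closedNbhd p∈N[g])

lemma5 : {n : ℕ} (G : Graph n) → Connected G → Helly G →
         (S : Fin n → Set) → DiamLe G S 2 →
         (v : Fin n) → ¬ S v → (k : ℕ) → DistSet G v S k →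
         -- here r = k + 1, i.e. dist(v,S) = r - 1 = k
         ∃[ p ] (Ball G v k p
                 × (∀ u → S u → Ball G v (suc k) u → ClosedNbhd G p u)
                 × ∃[ g ] (IsGate G v S k g × ClosedNbhd G g p))
lemma5 G conn helly S diam v v∉S zero ((_ , s∈S , here , _) , _) = ⊥-elim (v∉S s∈S)
lemma5 G conn helly S diam v v∉S (suc k) _ = Gate.projection-gate G conn helly S diam v k
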